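{- For every positive integer $n$, $\tau(n+1)\le \tau(n)+1$.
   Context: Multi-pass stack sorting: in a pass, the entries of the current input are pushed one at a time, in order, onto a stack; whenever the top of the stack is the smallest value not yet output, it is popped to the output (repeatedly); entries are never popped otherwise. When all input entries have been pushed and no pop is possible, if the stack is nonempty the remaining entries are returned to the input in their original relative order and a new pass begins. The tier $t(\sigma)$ of a permutation $\sigma$ is one less than the minimum number of passes needed to output $1,\dots,n$. For a positive integer $n$, $\tau(n)$ denotes the maximum of $t(\sigma)$ over all permutations $\sigma$ of length $n$. -}

module Defs where

open import Data.Nat using (ℕ; zero; suc; _≤_; _≡ᵇ_)
open import Data.Bool using (if_then_else_)
open import Data.List using (List; []; _∷_; reverse; map; upTo)
open import Data.Product using (_×_; _,_; proj₂; ∃-syntax)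
open import Data.List.Relation.Binary.Permutation.Propositional using (_↭_)
open import Relation.Binary.PropositionalEquality using (_≡_)

IsPerm : ℕ → List ℕ → Set
IsPerm n σ = σ ↭ map suc (upTo n)

-- The stack is a list with its top at the head.
-- popAll m st: repeatedly pop while the top equals m (the smallest value not
-- yet output); returns the new smallest-not-yet-output value and the stack.
popAll : ℕ → List ℕ → ℕ × List ℕ
popAll m [] = m , []
popAll m (y ∷ ys) = if y ≡ᵇ m then popAll (suc m) ys else (m , y ∷ ys)

-- At the end the remaining stack entries are returned to the input
-- in their original relative order (= reverse of the stack, top first).
passAux : ℕ → List ℕ → List ℕ → ℕ × List ℕ
passAux m [] st = m , reverse st
passAux m (x ∷ xs) st with popAll m (x ∷ st)
... | m' , st' = passAux m' xs st'

pass : ℕ × List ℕ → ℕ × List ℕ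
pass (m , inp) = passAux m inp []

-- k passes starting from state s = (smallest value not yet output, input).
passes : ℕ → ℕ × List ℕ → ℕ × List ℕ
passes zero s = s
passes (suc k) s = passes k (pass s)

SortedAfter : ℕ → List ℕ → Set
SortedAfter k σ = proj₂ (passes k (1 , σ)) ≡ []

IsTier : List ℕ → ℕ → Set
IsTier σ t = SortedAfter (suc t) σ × (∀ k → SortedAfter k σ → suc t ≤ k)

IsTau : ℕ → ℕ → Set
IsTau n k =
  (∃[ σ ] (IsPerm n σ × IsTier σ k)) ×
  (∀ σ t → IsPerm n σ → IsTier σ t → t ≤ k)

-- The first pass on a permutation σ of 1, …, n+1 outputs 1, so it leaves a
-- rearrangement of m, …, n+1 with m ≥ 2.  Lowering every entry by one gives a
-- rearrangement ρ of m−1, …, n, and π = 1, …, m−2 followed by ρ is a permutation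
-- of length n whose first pass outputs its prefix and then acts exactly like
-- the first pass on ρ.  Hence, from then on, the passes on π are the passes on
-- σ delayed by one pass and lowered by one, so t(π) = t(σ) − 1 ≤ τ(n).
module Submission where

open import Defs
open import Data.Nat using (ℕ; suc; _≤_; _+_; zero; _<_; _≡ᵇ_; z≤n; s≤s; s≤s⁻¹)
open import Data.Nat.Properties
  using (≤-refl; ≤-trans; <-≤-trans; n≤1+n; ≤∧≢⇒<; _≟_; ≡⇒≡ᵇ; ≡ᵇ⇒≡; +-identityʳ; +-suc; +-comm; suc-injective)
open import Data.Bool using (true; false; T)
open import Data.Empty using (⊥-elim)
open import Data.List using (List; []; _∷_; _++_; map; applyUpTo; upTo)
open import Data.List.Properties using (map-applyUpTo; reverse-map; ++-conicalʳ; ++-identityʳ)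
open import Data.List.Membership.Propositional using (_∈_)
open import Data.List.Relation.Unary.Any using (here; there)
open import Data.List.Relation.Binary.Permutation.Propositional using (_↭_; ↭-sym; ↭-trans; ↭-reflexive)
open import Data.List.Relation.Binary.Permutation.Propositional.Properties
  using (¬x∷xs↭[]; drop-∷; shift; ↭-reverse; ↭-map-inv; ++⁺ˡ; ∈-resp-↭)
open import Data.Product using (_×_; _,_; proj₁; proj₂; ∃-syntax)
import Data.Product as Product
open import Relation.Binary.PropositionalEquality
open import Relation.Nullary using (yes; no)

interval : ℕ → ℕ → List ℕ
interval m zero    = []
interval m (suc d) = m ∷ interval (suc m) d

applyUpTo-interval : ∀ (f : ℕ → ℕ) m d → (∀ i → f i ≡ m + i) → applyUpTo f d ≡ interval m d
applyUpTo-interval f m zero    f≗m+ = refl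
applyUpTo-interval f m (suc d) f≗m+ =
  cong₂ _∷_ (trans (f≗m+ 0) (+-identityʳ m))
            (applyUpTo-interval (λ i → f (suc i)) (suc m) d (λ i → trans (f≗m+ (suc i)) (+-suc m i)))

map-suc-upTo : ∀ n → map suc (upTo n) ≡ interval 1 n
map-suc-upTo n = trans (map-applyUpTo (λ i → i) suc n) (applyUpTo-interval suc 1 n (λ _ → refl))

interval-++ : ∀ m a b → interval m a ++ interval (m + a) b ≡ interval m (a + b)
interval-++ m zero    b = cong (λ k → interval k b) (+-identityʳ m)
interval-++ m (suc a) b =
  cong (m ∷_) (trans (cong (λ k → interval (suc m) a ++ interval k b) (+-suc m a)) (interval-++ (suc m) a b))

interval-suc : ∀ m d → interval (suc m) d ≡ map suc (interval m d)
interval-suc m zero    = refl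
interval-suc m (suc d) = cong (suc m ∷_) (interval-suc (suc m) d)

map-suc-≡[] : ∀ (xs : List ℕ) → map suc xs ≡ [] → xs ≡ []
map-suc-≡[] [] _ = refl

-- xs rearranges m, m+1, …, N−1: what is left to output once 1, …, m−1 are out (N is exclusive).
Remainder : ℕ → ℕ → List ℕ → Set
Remainder N m xs = ∃[ d ] (xs ↭ interval m d × m + d ≡ N)

Remainder-resp-↭ : ∀ {N m xs ys} → xs ↭ ys → Remainder N m ys → Remainder N m xs
Remainder-resp-↭ xs↭ys (d , ys↭ , e) = d , ↭-trans xs↭ys ys↭ , e

IsPerm⇒Remainder : ∀ {n σ} → IsPerm n σ → Remainder (suc n) 1 σ
IsPerm⇒Remainder {n} σ↭ = n , ↭-trans σ↭ (↭-reflexive (map-suc-upTo n)) , refl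

Remainder⇒IsPerm : ∀ {N q ρ} → Remainder (suc N) (suc q) ρ → IsPerm N (interval 1 q ++ ρ)
Remainder⇒IsPerm {N} {q} (d , ρ↭ , refl) = begin
  interval 1 q ++ _                     ↭⟨ ++⁺ˡ (interval 1 q) ρ↭ ⟩
  interval 1 q ++ interval (1 + q) d    ≡⟨ interval-++ 1 q d ⟩
  interval 1 (q + d)                    ≡⟨ map-suc-upTo (q + d) ⟨
  map suc (upTo (q + d))                ∎
  where open Data.List.Relation.Binary.Permutation.Propositional.PermutationReasoning

Remainder-lower : ∀ {N m xs} → Remainder (suc N) (suc m) xs →
  ∃[ ys ] (xs ≡ map suc ys × Remainder N m ys)
Remainder-lower {m = m} (d , xs↭ , e) with ↭-map-inv suc (↭-sym (↭-trans xs↭ (↭-reflexive (interval-suc m d))))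
... | ys , xs≡ , interval↭ys = ys , xs≡ , d , ↭-sym interval↭ys , suc-injective e

popAll-pops : ∀ m st → popAll m (m ∷ st) ≡ popAll (suc m) st
popAll-pops m st with m ≡ᵇ m | ≡⇒≡ᵇ m m refl
... | true | _ = refl

popAll-mono : ∀ m ys → m ≤ proj₁ (popAll m ys)
popAll-mono m []       = ≤-refl
popAll-mono m (y ∷ ys) with y ≡ᵇ m
... | true  = ≤-trans (n≤1+n m) (popAll-mono (suc m) ys)
... | false = ≤-refl

passAux-∷ : ∀ m x xs st →
  passAux m (x ∷ xs) st ≡ passAux (proj₁ (popAll m (x ∷ st))) xs (proj₂ (popAll m (x ∷ st)))
passAux-∷ m x xs st with popAll m (x ∷ st)
... | _ , _ = refl

passAux-mono : ∀ m xs st → m ≤ proj₁ (passAux m xs st)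
passAux-mono m []       st = ≤-refl
passAux-mono m (x ∷ xs) st rewrite passAux-∷ m x xs st =
  ≤-trans (popAll-mono m (x ∷ st)) (passAux-mono _ xs _)

passAux-outputs : ∀ m xs st → m ∈ xs → m < proj₁ (passAux m xs st)
passAux-outputs m (x ∷ xs) st m∈ rewrite passAux-∷ m x xs st
  with popAll m (x ∷ st) in eq | popAll-mono m (x ∷ st)
passAux-outputs m (m ∷ xs) st (here refl) | m' , st' | _ =
  ≤-trans (subst (λ p → suc m ≤ proj₁ p) (trans (sym (popAll-pops m st)) eq) (popAll-mono (suc m) st))
          (passAux-mono m' xs st')
passAux-outputs m (x ∷ xs) st (there m∈) | m' , st' | m≤m' with m' ≟ m
... | yes refl = passAux-outputs m xs st' m∈
... | no m'≢m  = <-≤-trans (≤∧≢⇒< m≤m' (λ e → m'≢m (sym e))) (passAux-mono m' xs st')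

popAll-Remainder : ∀ {N} m ys zs → Remainder N m (ys ++ zs) →
  Remainder N (proj₁ (popAll m ys)) (proj₂ (popAll m ys) ++ zs)
popAll-Remainder m []       zs r = r
popAll-Remainder m (y ∷ ys) zs r with y ≡ᵇ m in eq
... | false = r
... | true with ≡ᵇ⇒≡ y m (subst T (sym eq) _)
popAll-Remainder m (m ∷ ys) zs (zero  , ↭[] , _) | true | refl = ⊥-elim (¬x∷xs↭[] ↭[])
popAll-Remainder m (m ∷ ys) zs (suc d , ↭m∷ , e) | true | refl =
  popAll-Remainder (suc m) ys zs (d , drop-∷ ↭m∷ , trans (sym (+-suc m d)) e)

passAux-Remainder : ∀ {N} m xs st → Remainder N m (st ++ xs) →
  Remainder N (proj₁ (passAux m xs st)) (proj₂ (passAux m xs st))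
passAux-Remainder m []       st r =
  Remainder-resp-↭ (↭-trans (↭-reverse st) (↭-reflexive (sym (++-identityʳ st)))) r
passAux-Remainder m (x ∷ xs) st r rewrite passAux-∷ m x xs st =
  passAux-Remainder _ xs _ (popAll-Remainder m (x ∷ st) xs (Remainder-resp-↭ (↭-sym (shift x st xs)) r))

raise : ℕ × List ℕ → ℕ × List ℕ
raise = Product.map suc (map suc)

popAll-raise : ∀ m ys → popAll (suc m) (map suc ys) ≡ raise (popAll m ys)
popAll-raise m []       = refl
popAll-raise m (y ∷ ys) with y ≡ᵇ m
... | true  = popAll-raise (suc m) ys
... | false = refl

passAux-raise : ∀ m xs st → passAux (suc m) (map suc xs) (map suc st) ≡ raise (passAux m xs st)
passAux-raise m []       st = cong (suc m ,_) (sym (reverse-map suc st))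
passAux-raise m (x ∷ xs) st = begin
  passAux (suc m) (map suc (x ∷ xs)) (map suc st)
    ≡⟨ passAux-∷ (suc m) (suc x) (map suc xs) (map suc st) ⟩
  passAux (proj₁ (popAll (suc m) (map suc (x ∷ st)))) (map suc xs) (proj₂ (popAll (suc m) (map suc (x ∷ st))))
    ≡⟨ cong (λ p → passAux (proj₁ p) (map suc xs) (proj₂ p)) (popAll-raise m (x ∷ st)) ⟩
  passAux (suc (proj₁ (popAll m (x ∷ st)))) (map suc xs) (map suc (proj₂ (popAll m (x ∷ st))))
    ≡⟨ passAux-raise _ xs _ ⟩
  raise (passAux (proj₁ (popAll m (x ∷ st))) xs (proj₂ (popAll m (x ∷ st))))
    ≡⟨ cong raise (passAux-∷ m x xs st) ⟨
  raise (passAux m (x ∷ xs) st) ∎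
  where open ≡-Reasoning

passes-raise : ∀ k s → passes k (raise s) ≡ raise (passes k s)
passes-raise zero    s = refl
passes-raise (suc k) s rewrite passAux-raise (proj₁ s) (proj₂ s) [] = passes-raise k (pass s)

passAux-interval : ∀ m q xs → passAux m (interval m q ++ xs) [] ≡ passAux (m + q) xs []
passAux-interval m zero    xs = cong (λ k → passAux k xs []) (sym (+-identityʳ m))
passAux-interval m (suc q) xs = begin
  passAux m (m ∷ interval (suc m) q ++ xs) []
    ≡⟨ passAux-∷ m m (interval (suc m) q ++ xs) [] ⟩
  passAux (proj₁ (popAll m (m ∷ []))) (interval (suc m) q ++ xs) (proj₂ (popAll m (m ∷ [])))
    ≡⟨ cong (λ p → passAux (proj₁ p) (interval (suc m) q ++ xs) (proj₂ p)) (popAll-pops m []) ⟩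
  passAux (suc m) (interval (suc m) q ++ xs) []
    ≡⟨ passAux-interval (suc m) q xs ⟩
  passAux (suc m + q) xs []
    ≡⟨ cong (λ k → passAux k xs []) (+-suc m q) ⟨
  passAux (m + suc q) xs [] ∎
  where open ≡-Reasoning

first-pass : ∀ {n σ} → IsPerm (suc n) σ →
  ∃[ q ] ∃[ ρ ] (pass (1 , σ) ≡ raise (suc q , ρ) × Remainder (suc n) (suc q) ρ)
first-pass {n} {σ} σ↭ with passAux 1 σ [] | passAux-Remainder 1 σ [] (IsPerm⇒Remainder σ↭)
  | passAux-outputs 1 σ [] (∈-resp-↭ (↭-sym σ↭) (here refl))
... | suc (suc q) , L | r | s≤s (s≤s _) with Remainder-lower r
... | ρ , refl , r′ = q , ρ , refl , r′

IsTier-pred : ∀ {σ π t} →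
  (∀ k → SortedAfter k π → SortedAfter (suc k) σ) →
  (∀ k → SortedAfter (suc (suc k)) σ → SortedAfter (suc k) π) →
  IsTier σ (suc t) → IsTier π t
IsTier-pred {t = t} later earlier (sorted , minimal) = earlier t sorted , λ k h → s≤s⁻¹ (minimal (suc k) (later k h))

IsTier-drop : ∀ {n σ t} → IsPerm (suc n) σ → IsTier σ (suc t) → ∃[ π ] (IsPerm n π × IsTier π t)
IsTier-drop {σ = σ} σ↭ σ-tier with first-pass σ↭
... | q , ρ , first , r = interval 1 q ++ ρ , Remainder⇒IsPerm r , IsTier-pred later earlier σ-tier
  where
  σ-passes : ∀ k → proj₂ (passes (suc k) (1 , σ)) ≡ map suc (proj₂ (passes k (suc q , ρ)))
  σ-passes k = cong proj₂ (trans (cong (passes k) first) (passes-raise k (suc q , ρ)))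

  π-passes : ∀ k → passes (suc k) (1 , interval 1 q ++ ρ) ≡ passes (suc k) (suc q , ρ)
  π-passes k = cong (passes k) (passAux-interval 1 q ρ)

  later : ∀ k → SortedAfter k (interval 1 q ++ ρ) → SortedAfter (suc k) σ
  later zero    h = trans (σ-passes 0) (cong (map suc) (++-conicalʳ (interval 1 q) ρ h))
  later (suc k) h = trans (σ-passes (suc k)) (cong (map suc) (trans (sym (cong proj₂ (π-passes k))) h))

  earlier : ∀ k → SortedAfter (suc (suc k)) σ → SortedAfter (suc k) (interval 1 q ++ ρ)
  earlier k h = trans (cong proj₂ (π-passes k)) (map-suc-≡[] _ (trans (sym (σ-passes (suc k))) h))

lemma3p9 : ∀ (n : ℕ) → 1 ≤ n → ∀ (a b : ℕ) →
    IsTau (suc n) a → IsTau n b → a ≤ b + 1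
lemma3p9 n _ zero    b _ _ = z≤n
lemma3p9 n _ (suc t) b ((σ , σ↭ , σ-tier) , _) (_ , τ-max) with IsTier-drop σ↭ σ-tier
... | π , π↭ , π-tier = subst (suc t ≤_) (+-comm 1 b) (s≤s (τ-max π t π↭ π-tier))
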